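{- Let $T$ be the complete $q$-ary tree of depth $d$ ($q\ge 2$), and let $S\subseteq V(T)$ be both left-compressed and down-compressed. Let $u\in V(T)$ and let $i$ be such that $\mathrm{Desc}(u)\cap S\cap L_i\neq\emptyset$. Then $\mathrm{Desc}(u)\cap S\cap L_{i'}\neq\emptyset$ for every $i'$ with $i\le i'\le d$.
   Context: The complete $q$-ary tree of depth $d$ is the rooted tree in which every vertex at distance less than $d$ from the root has exactly $q$ children, and vertices at distance $d$ are leaves. $L_i$ is the set of vertices at distance $i$ from the root; $\mathrm{children}(w)$ denotes the children of $w$ and $\mathrm{Desc}(w)$ its descendants (vertices whose path to the root contains $w$, including $w$). The vertices are linearly ordered breadth-first: the root first; vertices of $L_i$ before those of $L_j$ for $i<j$; within a level, if $x$ precedes $y$ then all children of $x$ precede all children of $y$; children $w^{(1)},\dots,w^{(q)}$ of $w$ appear in this order. A vertex $x$ is to the left of $y$ if they are in the same level and $x$ precedes $y$. For $S\subseteq V(T)$, $\delta(S)=\{x\notin S: N(x)\cap S\neq\emptyset\}$. Two vertices $u,v$ are swappable in $S$ if $u$ is to the left of $v$ and either $u\notin S,\ v\in S$, or $u,v\notin S$, $\mathrm{children}(u)\cap S=\emptyset$, $\mathrm{children}(v)\cap S\ne\emptyset$. $S$ is left-compressed if no pair of vertices is swappable in $S$. Two vertices $u\in S$, $v\notin S$ are down-swappable in $S$ if either $|\delta((S\cup\{v\})\setminus\{u\})|<|\delta(S)|$, or $|\delta((S\cup\{v\})\setminus\{u\})|=|\delta(S)|$ and $v$ is further from the root than $u$.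 $S$ is down-compressed if no pair is down-swappable in $S$. -}

module Defs where

open import Data.Nat using (ℕ; zero; suc; _≤_; _<_)
open import Data.Fin using (Fin)
import Data.Fin as F
open import Data.Bool using (Bool; true; false; if_then_else_; not; _∧_; _∨_)
open import Data.List using (List; []; _∷_; _++_; [_]; length; map; concatMap; upTo; allFin)
open import Data.Bool.ListAction using (any)
open import Data.List.Properties using (≡-dec)
open import Data.List.Relation.Binary.Lex.Strict using (Lex-<)
open import Data.Product using (Σ; ∃; _×_; _,_)
open import Data.Sum using (_⊎_)
open import Relation.Nullary using (¬_; does)
open import Relation.Binary.PropositionalEquality using (_≡_)

-- A vertex is the path from the
-- root, i.e. a list of child-indices (Fin q) read root-first, of length ≤ d.
-- The root is [], the children of w are w ++ [ c ] (c = 0..q-1, in this order),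
-- and L_i consists of the paths of length i.

Path : ℕ → Set
Path q = List (Fin q)

IsVertex : {q : ℕ} → ℕ → Path q → Set
IsVertex d p = length p ≤ d

VSubset : ℕ → Set
VSubset q = Path q → Bool

ValidSubset : {q : ℕ} → ℕ → VSubset q → Set
ValidSubset d S = ∀ p → S p ≡ true → IsVertex d p

_∈S_ : {q : ℕ} → Path q → VSubset q → Set
x ∈S S = S x ≡ true

InDesc : {q : ℕ} → Path q → Path q → Set
InDesc u x = ∃ λ w → x ≡ u ++ w

-- x is to the left of y: same level, and x precedes y in breadth-first order,
-- which within a level is the lexicographic order of root-first paths.
LeftOf : {q : ℕ} → Path q → Path q → Set
LeftOf x y = length x ≡ length y × Lex-< _≡_ F._<_ x y

Swappable : {q : ℕ} → VSubset q → Path q → Path q → Set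
Swappable S u v =
  LeftOf u v ×
  ( (¬ (u ∈S S) × v ∈S S)
  ⊎ (¬ (u ∈S S) × ¬ (v ∈S S)
      × (∀ c → ¬ ((u ++ [ c ]) ∈S S))
      × (∃ λ c → (v ++ [ c ]) ∈S S)))

LeftCompressed : {q : ℕ} → ℕ → VSubset q → Set
LeftCompressed d S = ∀ u v → IsVertex d u → IsVertex d v → ¬ Swappable S u v

pathsOfLength : (q : ℕ) → ℕ → List (Path q)
pathsOfLength q zero = [ [] ]
pathsOfLength q (suc n) = concatMap (λ p → map (λ c → p ++ [ c ]) (allFin q)) (pathsOfLength q n)

allVertices : (q d : ℕ) → List (Path q)
allVertices q d = concatMap (pathsOfLength q) (upTo (suc d))

dropLast : {A : Set} → List A → List A
dropLast [] = []
dropLast (x ∷ []) = []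
dropLast (x ∷ y ∷ xs) = x ∷ dropLast (y ∷ xs)

hasNbrIn : {q : ℕ} → VSubset q → Path q → Bool
hasNbrIn {q} S [] = any (λ c → S ([] ++ [ c ])) (allFin q)
hasNbrIn {q} S (x ∷ xs) = S (dropLast (x ∷ xs)) ∨ any (λ c → S ((x ∷ xs) ++ [ c ])) (allFin q)

inBoundary : {q : ℕ} → VSubset q → Path q → Bool
inBoundary S x = not (S x) ∧ hasNbrIn S x

count : {A : Set} → (A → Bool) → List A → ℕ
count f [] = zero
count f (x ∷ xs) = if f x then suc (count f xs) else count f xs

boundarySize : (q d : ℕ) → VSubset q → ℕ
boundarySize q d S = count (inBoundary S) (allVertices q d)

_==_ : {q : ℕ} → Path q → Path q → Bool
x == y = does (≡-dec F._≟_ x y)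

swapSet : {q : ℕ} → VSubset q → Path q → Path q → VSubset q
swapSet S u v x = if x == u then false else (if x == v then true else S x)

DownSwappable : {q : ℕ} → ℕ → VSubset q → Path q → Path q → Set
DownSwappable {q} d S u v =
  u ∈S S × ¬ (v ∈S S) ×
  ( boundarySize q d (swapSet S u v) < boundarySize q d S
  ⊎ (boundarySize q d (swapSet S u v) ≡ boundarySize q d S × length u < length v))

DownCompressed : {q : ℕ} → ℕ → VSubset q → Set
DownCompressed d S = ∀ u v → IsVertex d u → IsVertex d v → ¬ DownSwappable d S u v

-- The heart of the proof is that every member x of S above the bottom level has a child
-- in S; iterating this from a member of Desc(u) on level i reaches every deeper level.
--
-- Suppose x ∈ S has no child in S and let x₀ be its first child. In each case below x is
-- moved to a non-member v deeper than x and |δ(S)| does not grow, contradicting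
-- down-compression.
--  • If x₀ is a leaf or all children of x₀ lie in S, take v = x₀: x₀ leaves the boundary
--    and only x can enter it.
--  • If x₀ has children both in and out of S, left-compression puts the first child of x₀
--    in S and every grandchild of x outside Desc(x₀) out of S. Take v = x₀: all q children
--    of x leave the boundary, and only x and the q − 1 later children of x₀ can enter.
--  • If no child of x₀ is in S, left-compression empties the whole grandchild level of x.
--    Descend from the first child of x₀ to a non-member v all of whose children lie in S:
--    the q children of x leave the boundary and only x and the parent of v can enter,
--    which is where q ≥ 2 is needed.
-- The boundary comparison is a double count over the enumeration of V(T), in which every
-- vertex occurs exactly once.

module Submission where

open import Defs
open import Data.Nat using (ℕ; zero; suc; _+_; _∸_; _≤_; _<_; z≤n; s≤s; _≡ᵇ_; _≟_; _<?_)
open import Data.Nat.Properties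
open import Algebra.Properties.CommutativeSemigroup +-commutativeSemigroup using () renaming (interchange to +-interchange)
open import Data.Fin as F using (Fin; zero; suc)
import Data.Fin.Properties as FP
open import Data.Bool using (Bool; true; false; _∨_)
import Data.Bool.Properties as BP
open BP using (¬-not)
open import Data.Bool.ListAction using (any)
open import Data.List using (List; []; _∷_; _++_; [_]; length; map; concatMap; applyUpTo; upTo; allFin; tabulate)
open import Data.List.Base using (initLast; _∷ʳ′_)
open import Data.List.Properties using (∷ʳ-injectiveˡ; ∷ʳ-injectiveʳ; length-++; length-map; length-tabulate; ++-assoc; ++-identityʳ; ≡-dec)
open import Data.List.Membership.Propositional using (_∈_; _∉_; find; lose)
open import Data.List.Membership.Propositional.Properties using (∈-concatMap⁻; ∈-map⁻; ∈-map⁺; ∈-upTo⁻; ∈-allFin)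
open import Data.List.Relation.Unary.Any using (here; there; satisfied)
open import Data.List.Relation.Unary.Any.Properties using (any⁺; any⁻)
open import Function.Bundles using (Equivalence)
open import Data.List.Relation.Binary.Lex.Strict using (Lex-<; this; next)
open import Data.Product using (∃; _×_; _,_; proj₁; map₂)
open import Data.Sum using (_⊎_; inj₁; inj₂)
open import Data.Empty using (⊥; ⊥-elim)
open import Function using (_∘_; id)
open import Relation.Nullary using (¬_; yes; no; contradiction)
open import Relation.Nullary.Decidable using (dec-true; dec-false)
open import Relation.Binary.PropositionalEquality hiding ([_])

≡false⇒≢true : {b : Bool} → b ≡ false → b ≢ true
≡false⇒≢true refl ()

∨-≡true⁻ : ∀ a {b} → a ∨ b ≡ true → a ≡ true ⊎ b ≡ true
∨-≡true⁻ true e = inj₁ refl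
∨-≡true⁻ false e = inj₂ e

∨-≡trueʳ : ∀ a {b} → b ≡ true → a ∨ b ≡ true
∨-≡trueʳ true e = refl
∨-≡trueʳ false e = e

module _ {A : Set} (p : A → Bool) where
  open Equivalence using (to; from)

  any-≡true⁻ : (xs : List A) → any p xs ≡ true → ∃ λ a → p a ≡ true
  any-≡true⁻ xs e = map₂ (to BP.T-≡) (satisfied (any⁻ p xs (from BP.T-≡ e)))

  any-≡true⁺ : {xs : List A} {a : A} → a ∈ xs → p a ≡ true → any p xs ≡ true
  any-≡true⁺ a∈xs e = to BP.T-≡ (any⁺ p (lose a∈xs (from BP.T-≡ e)))

-- Finite sums

𝟙 : Bool → ℕ
𝟙 true = 1
𝟙 false = 0

𝟙≤1 : ∀ b → 𝟙 b ≤ 1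
𝟙≤1 true = ≤-refl
𝟙≤1 false = z≤n

∑ : {A : Set} → (A → ℕ) → List A → ℕ
∑ h [] = 0
∑ h (a ∷ l) = h a + ∑ h l

module _ {A : Set} where
  count≡∑𝟙 : (f : A → Bool) (l : List A) → count f l ≡ ∑ (𝟙 ∘ f) l
  count≡∑𝟙 f [] = refl
  count≡∑𝟙 f (a ∷ l) with f a
  ... | true = cong suc (count≡∑𝟙 f l)
  ... | false = count≡∑𝟙 f l

  ∑-cong : {h g : A → ℕ} (l : List A) → (∀ a → a ∈ l → h a ≡ g a) → ∑ h l ≡ ∑ g l
  ∑-cong [] p = refl
  ∑-cong (a ∷ l) p = cong₂ _+_ (p a (here refl)) (∑-cong l (λ b → p b ∘ there))

  ∑-mono-≤ : {h g : A → ℕ} (l : List A) → (∀ a → a ∈ l → h a ≤ g a) → ∑ h l ≤ ∑ g l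
  ∑-mono-≤ [] p = z≤n
  ∑-mono-≤ (a ∷ l) p = +-mono-≤ (p a (here refl)) (∑-mono-≤ l (λ b → p b ∘ there))

  ∑-zero : {h : A → ℕ} (l : List A) → (∀ a → h a ≡ 0) → ∑ h l ≡ 0
  ∑-zero [] p = refl
  ∑-zero (a ∷ l) p = cong₂ _+_ (p a) (∑-zero l p)

  ∑-const-1 : (l : List A) → ∑ (λ _ → 1) l ≡ length l
  ∑-const-1 [] = refl
  ∑-const-1 (a ∷ l) = cong suc (∑-const-1 l)

  ∑-+ : (h g : A → ℕ) (l : List A) → ∑ (λ a → h a + g a) l ≡ ∑ h l + ∑ g l
  ∑-+ h g [] = refl
  ∑-+ h g (a ∷ l) = trans (cong (h a + g a +_) (∑-+ h g l)) (+-interchange (h a) (g a) (∑ h l) (∑ g l))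

  ∑-++ : (h : A → ℕ) (l₁ l₂ : List A) → ∑ h (l₁ ++ l₂) ≡ ∑ h l₁ + ∑ h l₂
  ∑-++ h [] l₂ = refl
  ∑-++ h (a ∷ l₁) l₂ = trans (cong (h a +_) (∑-++ h l₁ l₂)) (sym (+-assoc (h a) _ _))

  ∑-tabulate-zero : ∀ {n} (h : A → ℕ) (g : Fin n → A) → (∀ j → h (g j) ≡ 0) → ∑ h (tabulate g) ≡ 0
  ∑-tabulate-zero {zero} h g p = refl
  ∑-tabulate-zero {suc n} h g p = cong₂ _+_ (p zero) (∑-tabulate-zero h (g ∘ suc) (p ∘ suc))

  ∑-tabulate-single : ∀ {n} (h : A → ℕ) (g : Fin n → A) (i : Fin n)
    → (∀ j → j ≢ i → h (g j) ≡ 0) → ∑ h (tabulate g) ≡ h (g i)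
  ∑-tabulate-single h g zero others =
    trans (cong (h (g zero) +_) (∑-tabulate-zero h (g ∘ suc) (λ j → others (suc j) λ ()))) (+-identityʳ _)
  ∑-tabulate-single h g (suc i) others =
    cong₂ _+_ (others zero λ ()) (∑-tabulate-single h (g ∘ suc) i (λ j j≢i → others (suc j) (j≢i ∘ FP.suc-injective)))

  ∑-applyUpTo-zero : ∀ n (h : A → ℕ) (g : ℕ → A) → (∀ j → h (g j) ≡ 0) → ∑ h (applyUpTo g n) ≡ 0
  ∑-applyUpTo-zero zero h g p = refl
  ∑-applyUpTo-zero (suc n) h g p = cong₂ _+_ (p 0) (∑-applyUpTo-zero n h (g ∘ suc) (p ∘ suc))

  ∑-applyUpTo-single : (h : A → ℕ) (g : ℕ → A) {n m : ℕ} → m < n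
    → (∀ j → j ≢ m → h (g j) ≡ 0) → ∑ h (applyUpTo g n) ≡ h (g m)
  ∑-applyUpTo-single h g {suc n} {zero} _ others =
    trans (cong (h (g 0) +_) (∑-applyUpTo-zero n h (g ∘ suc) (λ j → others (suc j) λ ()))) (+-identityʳ _)
  ∑-applyUpTo-single h g {suc n} {suc m} (s≤s m<n) others =
    cong₂ _+_ (others 0 λ ()) (∑-applyUpTo-single h (g ∘ suc) m<n (λ j j≢m → others (suc j) (j≢m ∘ suc-injective)))

module _ {A B : Set} where
  ∑-map : (h : B → ℕ) (f : A → B) (l : List A) → ∑ h (map f l) ≡ ∑ (h ∘ f) l
  ∑-map h f [] = refl
  ∑-map h f (a ∷ l) = cong (h (f a) +_) (∑-map h f l)

  ∑-concatMap : (h : B → ℕ) (f : A → List B) (l : List A) → ∑ h (concatMap f l) ≡ ∑ (∑ h ∘ f) l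
  ∑-concatMap h f [] = refl
  ∑-concatMap h f (a ∷ l) = trans (∑-++ h (f a) (concatMap f l)) (cong (∑ h (f a) +_) (∑-concatMap h f l))

  ∑-comm : (k : A → B → ℕ) (l : List A) (m : List B) → ∑ (λ a → ∑ (k a) m) l ≡ ∑ (λ b → ∑ (λ a → k a b) l) m
  ∑-comm k [] m = sym (∑-zero m (λ _ → refl))
  ∑-comm k (a ∷ l) m = trans (cong (∑ (k a) m +_) (∑-comm k l m)) (sym (∑-+ (k a) _ m))

module _ {A : Set} where
  length-∷ʳ : (xs : List A) (x : A) → length (xs ++ [ x ]) ≡ suc (length xs)
  length-∷ʳ xs x = trans (length-++ xs) (+-comm (length xs) 1)

  ∷ʳ≢[] : (xs : List A) (x : A) → xs ++ [ x ] ≢ []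
  ∷ʳ≢[] [] x ()
  ∷ʳ≢[] (y ∷ xs) x ()

  +-length-∷ʳ : ∀ k (xs : List A) (x : A) → k + length (xs ++ [ x ]) ≡ suc (k + length xs)
  +-length-∷ʳ k xs x = trans (cong (k +_) (length-∷ʳ xs x)) (+-suc k (length xs))

  length-dropLast : (xs : List A) → length (dropLast xs) ≤ length xs
  length-dropLast [] = z≤n
  length-dropLast (a ∷ []) = z≤n
  length-dropLast (a ∷ b ∷ xs) = s≤s (length-dropLast (b ∷ xs))

  dropLast-∷ʳ : (xs : List A) (x : A) → dropLast (xs ++ [ x ]) ≡ xs
  dropLast-∷ʳ [] x = refl
  dropLast-∷ʳ (a ∷ []) x = refl
  dropLast-∷ʳ (a ∷ b ∷ xs) x = cong (a ∷_) (dropLast-∷ʳ (b ∷ xs) x)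

-- Multiplicities in the vertex enumeration

module _ {q : ℕ} where
  ==-refl : (x : Path q) → (x == x) ≡ true
  ==-refl x = dec-true (≡-dec F._≟_ x x) refl

  ==-≢ : {x y : Path q} → x ≢ y → (x == y) ≡ false
  ==-≢ {x} {y} = dec-false (≡-dec F._≟_ x y)

  ==-comm : (x y : Path q) → (x == y) ≡ (y == x)
  ==-comm x y with ≡-dec F._≟_ x y
  ... | yes refl = sym (==-refl x)
  ... | no x≢y = sym (==-≢ (x≢y ∘ sym))

  children : Path q → List (Path q)
  children p = map (λ c → p ++ [ c ]) (allFin q)

  length-children : (p : Path q) → length (children p) ≡ q
  length-children p = trans (length-map _ (allFin q)) (length-tabulate id)

  ∈-children⁻ : {p y : Path q} → y ∈ children p → ∃ λ c → y ≡ p ++ [ c ]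
  ∈-children⁻ y∈ with ∈-map⁻ _ y∈
  ... | c , _ , y≡ = c , y≡

  mult : List (Path q) → Path q → ℕ
  mult L a = ∑ (λ y → 𝟙 (y == a)) L

  mult-∈ : {L : List (Path q)} {a : Path q} → a ∈ L → 1 ≤ mult L a
  mult-∈ {a = a} (here refl) rewrite ==-refl a = s≤s z≤n
  mult-∈ {b ∷ L} (there a∈L) = ≤-trans (mult-∈ a∈L) (m≤n+m _ _)

  mult-∉ : {L : List (Path q)} {a : Path q} → a ∉ L → mult L a ≡ 0
  mult-∉ {[]} a∉L = refl
  mult-∉ {b ∷ L} a∉L rewrite ==-≢ (a∉L ∘ here ∘ sym) = mult-∉ (a∉L ∘ there)

  mult-[_] : (a y : Path q) → mult [ a ] y ≤ 1
  mult-[ a ] y = ≤-trans (≤-reflexive (+-identityʳ _)) (𝟙≤1 (a == y))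

  mult-children : (p a : Path q) → mult (children p) a ≡ ∑ (λ c → 𝟙 ((p ++ [ c ]) == a)) (allFin q)
  mult-children p a = ∑-map (λ y → 𝟙 (y == a)) (λ c → p ++ [ c ]) (allFin q)

  mult-children-[] : (p : Path q) → mult (children p) [] ≡ 0
  mult-children-[] p = trans (mult-children p []) (∑-tabulate-zero (λ c → 𝟙 ((p ++ [ c ]) == [])) id (λ c → cong 𝟙 (==-≢ (∷ʳ≢[] p c))))

  mult-children-∷ʳ : (p a : Path q) (c : Fin q) → mult (children p) (a ++ [ c ]) ≡ 𝟙 (p == a)
  mult-children-∷ʳ p a c with ≡-dec F._≟_ p a
  ... | yes refl = trans (mult-children p (p ++ [ c ])) (trans
          (∑-tabulate-single (λ j → 𝟙 ((p ++ [ j ]) == (p ++ [ c ]))) id c (λ j j≢c → cong 𝟙 (==-≢ (j≢c ∘ ∷ʳ-injectiveʳ p p))))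
          (cong 𝟙 (==-refl (p ++ [ c ]))))
  ... | no p≢a = trans (mult-children p (a ++ [ c ]))
          (∑-tabulate-zero (λ j → 𝟙 ((p ++ [ j ]) == (a ++ [ c ]))) id (λ j → cong 𝟙 (==-≢ (p≢a ∘ ∷ʳ-injectiveˡ p a))))

  mult-children-≤1 : (p y : Path q) → mult (children p) y ≤ 1
  mult-children-≤1 p y with initLast y
  ... | [] = ≤-trans (≤-reflexive (mult-children-[] p)) z≤n
  ... | a ∷ʳ′ c = ≤-trans (≤-reflexive (mult-children-∷ʳ p a c)) (𝟙≤1 (p == a))

  mult-pathsOfLength : ∀ n (a : Path q) → mult (pathsOfLength q n) a ≡ 𝟙 (length a ≡ᵇ n)
  mult-pathsOfLength zero [] = refl
  mult-pathsOfLength zero (x ∷ a) = refl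
  mult-pathsOfLength (suc n) a with initLast a
  ... | [] = trans (∑-concatMap _ children (pathsOfLength q n))
               (∑-zero (pathsOfLength q n) mult-children-[])
  ... | a′ ∷ʳ′ c = begin
      mult (pathsOfLength q (suc n)) (a′ ++ [ c ])           ≡⟨ ∑-concatMap _ children (pathsOfLength q n) ⟩
      ∑ (λ p → mult (children p) (a′ ++ [ c ])) (pathsOfLength q n) ≡⟨ ∑-cong (pathsOfLength q n) (λ p _ → mult-children-∷ʳ p a′ c) ⟩
      mult (pathsOfLength q n) a′                              ≡⟨ mult-pathsOfLength n a′ ⟩
      𝟙 (length a′ ≡ᵇ n)                                       ≡⟨ cong (λ l → 𝟙 (l ≡ᵇ suc n)) (length-∷ʳ a′ c) ⟨
      𝟙 (length (a′ ++ [ c ]) ≡ᵇ suc n)                        ∎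
    where open ≡-Reasoning

  mult-allVertices : ∀ d (a : Path q) → IsVertex d a → mult (allVertices q d) a ≡ 1
  mult-allVertices d a a≤d = begin
    mult (allVertices q d) a                             ≡⟨ ∑-concatMap _ (pathsOfLength q) (upTo (suc d)) ⟩
    ∑ (λ n → mult (pathsOfLength q n) a) (upTo (suc d))  ≡⟨ ∑-cong (upTo (suc d)) (λ n _ → mult-pathsOfLength n a) ⟩
    ∑ (λ n → 𝟙 (length a ≡ᵇ n)) (upTo (suc d))           ≡⟨ ∑-applyUpTo-single (λ n → 𝟙 (length a ≡ᵇ n)) id (s≤s a≤d)
                                                             (λ n n≢a → cong 𝟙 (dec-false (length a ≟ n) (n≢a ∘ sym))) ⟩
    𝟙 (length a ≡ᵇ length a)                             ≡⟨ cong 𝟙 (dec-true (length a ≟ length a) refl) ⟩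
    1                                                    ∎
    where open ≡-Reasoning

  ∈-pathsOfLength⁻ : ∀ n {y : Path q} → y ∈ pathsOfLength q n → length y ≡ n
  ∈-pathsOfLength⁻ zero (here refl) = refl
  ∈-pathsOfLength⁻ (suc n) y∈ with find (∈-concatMap⁻ children {xs = pathsOfLength q n} y∈)
  ... | p , p∈ , y∈children-p with ∈-children⁻ y∈children-p
  ...   | c , refl = trans (length-∷ʳ p c) (cong suc (∈-pathsOfLength⁻ n p∈))

  ∈-allVertices⁻ : ∀ d {y : Path q} → y ∈ allVertices q d → IsVertex d y
  ∈-allVertices⁻ d y∈ with find (∈-concatMap⁻ (pathsOfLength q) {xs = upTo (suc d)} y∈)
  ... | n , n∈ , y∈paths rewrite ∈-pathsOfLength⁻ n y∈paths = ≤-pred (∈-upTo⁻ n∈)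

  ∑-mult-allVertices : ∀ d (L : List (Path q)) → (∀ a → a ∈ L → IsVertex d a)
    → ∑ (mult L) (allVertices q d) ≡ length L
  ∑-mult-allVertices d L L-vertices = begin
    ∑ (λ y → ∑ (λ a → 𝟙 (a == y)) L) V  ≡⟨ ∑-comm (λ y a → 𝟙 (a == y)) V L ⟩
    ∑ (λ a → ∑ (λ y → 𝟙 (a == y)) V) L  ≡⟨ ∑-cong L (λ a a∈L → trans (∑-cong V (λ y _ → cong 𝟙 (==-comm a y)))
                                                                       (mult-allVertices d a (L-vertices a a∈L))) ⟩
    ∑ (λ _ → 1) L                        ≡⟨ ∑-const-1 L ⟩
    length L                             ∎
    where
    open ≡-Reasoning
    V = allVertices q d

-- Neighbourhoods and boundaries

module _ {q : ℕ} where
  ChildOf : Path q → Path q → Set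
  ChildOf y z = ∃ λ c → y ≡ z ++ [ c ]

  Adjacent : Path q → Path q → Set
  Adjacent y z = ChildOf y z ⊎ ChildOf z y

  hasChildIn : VSubset q → Path q → Bool
  hasChildIn T y = any (λ c → T (y ++ [ c ])) (allFin q)

  hasNbrIn-∷ʳ : (T : VSubset q) (p : Path q) (c : Fin q) → hasNbrIn T (p ++ [ c ]) ≡ T p ∨ hasChildIn T (p ++ [ c ])
  hasNbrIn-∷ʳ T [] c = refl
  hasNbrIn-∷ʳ T (a ∷ p) c = cong (λ z → T z ∨ hasChildIn T (a ∷ p ++ [ c ])) (dropLast-∷ʳ (a ∷ p) c)

  hasNbrIn⁻ : (T : VSubset q) (y : Path q) → hasNbrIn T y ≡ true → ∃ λ z → Adjacent y z × T z ≡ true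
  hasNbrIn⁻ T y e with initLast y
  ... | [] with any-≡true⁻ _ (allFin q) e
  ...   | c , Tc = [ c ] , inj₂ (c , refl) , Tc
  hasNbrIn⁻ T y e | p ∷ʳ′ c with ∨-≡true⁻ (T p) (trans (sym (hasNbrIn-∷ʳ T p c)) e)
  ...   | inj₁ Tp = p , inj₁ (c , refl) , Tp
  ...   | inj₂ child with any-≡true⁻ _ (allFin q) child
  ...     | c′ , Tc′ = (p ++ [ c ]) ++ [ c′ ] , inj₂ (c′ , refl) , Tc′

  hasNbrIn⁺ : (T : VSubset q) {y z : Path q} → Adjacent y z → T z ≡ true → hasNbrIn T y ≡ true
  hasNbrIn⁺ T {z = z} (inj₁ (c , refl)) Tz = trans (hasNbrIn-∷ʳ T z c) (cong (_∨ hasChildIn T (z ++ [ c ])) Tz)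
  hasNbrIn⁺ T {[]} (inj₂ (c , refl)) Tz = any-≡true⁺ _ (∈-allFin c) Tz
  hasNbrIn⁺ T {a ∷ y} (inj₂ (c , refl)) Tz = ∨-≡trueʳ (T (dropLast (a ∷ y))) (any-≡true⁺ _ (∈-allFin c) Tz)

  inBoundary⁺ : (T : VSubset q) {y z : Path q} → T y ≡ false → Adjacent y z → T z ≡ true → inBoundary T y ≡ true
  inBoundary⁺ T {y} Ty y~z Tz rewrite Ty = hasNbrIn⁺ T y~z Tz

  inBoundary⁻ : (T : VSubset q) (y : Path q) → inBoundary T y ≡ true
    → T y ≡ false × ∃ λ z → Adjacent y z × T z ≡ true
  inBoundary⁻ T y e with T y
  ... | false = refl , hasNbrIn⁻ T y e

  inBoundary⇒∉ : (T : VSubset q) {y : Path q} → inBoundary T y ≡ true → T y ≢ true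
  inBoundary⇒∉ T {y} e = ≡false⇒≢true (proj₁ (inBoundary⁻ T y e))

  swapSet-target : (S : VSubset q) {u v : Path q} → u ≢ v → swapSet S u v v ≡ true
  swapSet-target S {u} {v} u≢v rewrite ==-≢ (u≢v ∘ sym) | ==-refl v = refl

  swapSet-≡true⁻ : (S : VSubset q) (u v z : Path q) → swapSet S u v z ≡ true → z ≡ v ⊎ (z ≢ u × S z ≡ true)
  swapSet-≡true⁻ S u v z e with ≡-dec F._≟_ z u | ≡-dec F._≟_ z v
  ... | yes _ | _ with () ← e
  ... | no z≢u | yes z≡v = inj₁ z≡v
  ... | no z≢u | no z≢v = inj₂ (z≢u , e)

  inBoundary-swapSet : (S : VSubset q) (u v y : Path q) → inBoundary (swapSet S u v) y ≡ true
    → y ≡ u ⊎ inBoundary S y ≡ true ⊎ (S y ≡ false × y ≢ u × Adjacent y v)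
  inBoundary-swapSet S u v y e with inBoundary⁻ (swapSet S u v) y e
  ... | S′y , z , y~z , S′z with ≡-dec F._≟_ y u
  ...   | yes y≡u = inj₁ y≡u
  ...   | no y≢u with ≡-dec F._≟_ y v
  ...     | yes refl with () ← S′y
  ...     | no y≢v with swapSet-≡true⁻ S u v z S′z
  ...       | inj₁ refl = inj₂ (inj₂ (S′y , y≢u , y~z))
  ...       | inj₂ (_ , Sz) = inj₂ (inj₁ (inBoundary⁺ S S′y y~z Sz))

  open import Data.List.Membership.DecPropositional (≡-dec (F._≟_ {q})) using (_∈?_)

  record BoundaryExchange (d : ℕ) (S S′ : VSubset q) : Set where
    field
      leaving entering : List (Path q)
      leaving-vertices : ∀ a → a ∈ leaving → IsVertex d a
      entering-vertices : ∀ a → a ∈ entering → IsVertex d a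
      leaving-distinct : ∀ y → mult leaving y ≤ 1
      entering≤leaving : length entering ≤ length leaving
      leaving⊆δS : ∀ y → y ∈ leaving → inBoundary S y ≡ true
      δS′⊆δS∪entering : ∀ y → IsVertex d y → inBoundary S′ y ≡ true → inBoundary S y ≡ true ⊎ y ∈ entering
      leaving∩δS′⊆entering : ∀ y → y ∈ leaving → inBoundary S′ y ≡ true → y ∈ entering

    pointwise : ∀ y → IsVertex d y
      → 𝟙 (inBoundary S′ y) + mult leaving y ≤ 𝟙 (inBoundary S y) + mult entering y
    pointwise y y-vertex with y ∈? leaving
    ... | yes y∈L rewrite leaving⊆δS y y∈L with inBoundary S′ y in δS′y
    ...   | true = +-monoʳ-≤ 1 (≤-trans (leaving-distinct y) (mult-∈ (leaving∩δS′⊆entering y y∈L δS′y)))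
    ...   | false = ≤-trans (leaving-distinct y) (s≤s z≤n)
    pointwise y y-vertex | no y∉L rewrite mult-∉ y∉L with inBoundary S′ y in δS′y
    ...   | false = z≤n
    ...   | true with δS′⊆δS∪entering y y-vertex δS′y
    ...     | inj₁ δSy rewrite δSy = s≤s z≤n
    ...     | inj₂ y∈E = ≤-trans (mult-∈ y∈E) (m≤n+m _ _)

    boundarySize-≤ : boundarySize q d S′ ≤ boundarySize q d S
    boundarySize-≤ = +-cancelʳ-≤ (length leaving) _ _ (begin
      boundarySize q d S′ + length leaving
        ≡⟨ cong₂ _+_ (count≡∑𝟙 (inBoundary S′) V) (sym (∑-mult-allVertices d leaving leaving-vertices)) ⟩
      ∑ (𝟙 ∘ inBoundary S′) V + ∑ (mult leaving) V
        ≡⟨ ∑-+ (𝟙 ∘ inBoundary S′) (mult leaving) V ⟨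
      ∑ (λ y → 𝟙 (inBoundary S′ y) + mult leaving y) V
        ≤⟨ ∑-mono-≤ V (λ y y∈V → pointwise y (∈-allVertices⁻ d y∈V)) ⟩
      ∑ (λ y → 𝟙 (inBoundary S y) + mult entering y) V
        ≡⟨ ∑-+ (𝟙 ∘ inBoundary S) (mult entering) V ⟩
      ∑ (𝟙 ∘ inBoundary S) V + ∑ (mult entering) V
        ≡⟨ cong₂ _+_ (sym (count≡∑𝟙 (inBoundary S) V)) (∑-mult-allVertices d entering entering-vertices) ⟩
      boundarySize q d S + length entering
        ≤⟨ +-monoʳ-≤ (boundarySize q d S) entering≤leaving ⟩
      boundarySize q d S + length leaving ∎)
      where
      open ≤-Reasoning
      V = allVertices q d

  length-sibling : (p : Path q) (a b : Fin q) → length (p ++ [ a ]) ≡ length (p ++ [ b ])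
  length-sibling p a b = trans (length-∷ʳ p a) (sym (length-∷ʳ p b))

  length-grandchild : (p : Path q) (a b : Fin q) → length ((p ++ [ a ]) ++ [ b ]) ≡ suc (suc (length p))
  length-grandchild p a b = trans (length-∷ʳ (p ++ [ a ]) b) (cong suc (length-∷ʳ p a))

  adjacent⇒length≢ : {y z : Path q} → Adjacent y z → length y ≢ length z
  adjacent⇒length≢ {z = z} (inj₁ (c , refl)) eq = <-irrefl (sym eq) (≤-reflexive (sym (length-∷ʳ z c)))
  adjacent⇒length≢ {y = y} (inj₂ (c , refl)) eq = <-irrefl eq (≤-reflexive (sym (length-∷ʳ y c)))

  Lex-<-after-prefix : (p : Path q) {a b : Fin q} (s t : Path q) → a F.< b → Lex-< _≡_ F._<_ (p ++ a ∷ s) (p ++ b ∷ t)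
  Lex-<-after-prefix [] s t a<b = this a<b
  Lex-<-after-prefix (c ∷ p) s t a<b = next refl (Lex-<-after-prefix p s t a<b)

  Lex-<-grandchild : (p : Path q) {a b : Fin q} (c c′ : Fin q) → a F.< b
    → Lex-< _≡_ F._<_ ((p ++ [ a ]) ++ [ c ]) ((p ++ [ b ]) ++ [ c′ ])
  Lex-<-grandchild p {a} {b} c c′ a<b =
    subst₂ (Lex-< _≡_ F._<_) (sym (++-assoc p [ a ] [ c ])) (sym (++-assoc p [ b ] [ c′ ])) (Lex-<-after-prefix p [ c ] [ c′ ] a<b)

  ChildrenIn : ℕ → VSubset q → Path q → Set
  ChildrenIn d T v = length v < d → ∀ c → T (v ++ [ c ]) ≡ true

  ∉-descendant-with-children-in : (d : ℕ) (T : VSubset q) {w : Path q} → IsVertex d w → T w ≡ false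
    → ∃ λ v → InDesc w v × IsVertex d v × T v ≡ false × ChildrenIn d T v
  ∉-descendant-with-children-in d T {w} w≤d = go (d ∸ length w) (m+[n∸m]≡n w≤d)
    where
    stop : ∀ {w} → IsVertex d w → T w ≡ false → ChildrenIn d T w → ∃ λ v → InDesc w v × IsVertex d v × T v ≡ false × ChildrenIn d T v
    stop {w} w≤d Tw children∈T = w , ([] , sym (++-identityʳ w)) , w≤d , Tw , children∈T

    go : ∀ n {w} → length w + n ≡ d → T w ≡ false → ∃ λ v → InDesc w v × IsVertex d v × T v ≡ false × ChildrenIn d T v
    go zero {w} |w|≡d Tw = stop (≤-reflexive w≡) Tw (λ w<d → contradiction w≡ (<⇒≢ w<d))
      where w≡ = trans (sym (+-identityʳ (length w))) |w|≡d
    go (suc n) {w} |w|+1+n≡d Tw with FP.any? (λ c → T (w ++ [ c ]) BP.≟ false)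
    ... | no none = stop (≤-trans (m≤m+n (length w) (suc n)) (≤-reflexive |w|+1+n≡d)) Tw (λ _ c → ¬-not (none ∘ (c ,_)))
    ... | yes (c , Twc) with go n (trans (cong (_+ n) (length-∷ʳ w c)) (trans (sym (+-suc (length w) n)) |w|+1+n≡d)) Twc
    ...   | v , (t , v≡) , rest = v , (c ∷ t , trans v≡ (++-assoc w [ c ] t)) , rest

-- Left- and down-compressed sets

module Compressed (r d : ℕ) (S : VSubset (suc (suc r)))
                  (left-compressed : LeftCompressed d S) (down-compressed : DownCompressed d S) where
  Q : ℕ
  Q = suc (suc r)

  ∉-rightward : {a b : Path Q} → IsVertex d b → length a ≡ length b → Lex-< _≡_ F._<_ a b → S a ≡ false → S b ≡ false
  ∉-rightward {a} {b} b≤d |a|≡|b| a<b Sa = ¬-not λ Sb →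
    left-compressed a b (subst (_≤ d) (sym |a|≡|b|) b≤d) b≤d ((|a|≡|b| , a<b) , inj₁ (≡false⇒≢true Sa , Sb))

  deeper-swap-grows-boundary : {x v : Path Q} → IsVertex d x → IsVertex d v → S x ≡ true → S v ≡ false
    → length x < length v → ¬ (boundarySize Q d (swapSet S x v) ≤ boundarySize Q d S)
  deeper-swap-grows-boundary x≤d v≤d Sx Sv x<v δ≤ with m≤n⇒m<n∨m≡n δ≤
  ... | inj₁ δ< = down-compressed _ _ x≤d v≤d (Sx , ≡false⇒≢true Sv , inj₁ δ<)
  ... | inj₂ δ≡ = down-compressed _ _ x≤d v≤d (Sx , ≡false⇒≢true Sv , inj₂ (δ≡ , x<v))

  module Childless {x : Path Q} (x<d : length x < d) (Sx : S x ≡ true) (childless : ∀ c → S (x ++ [ c ]) ≡ false) where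
    first : Path Q
    first = x ++ [ zero ]

    x≤d : IsVertex d x
    x≤d = <⇒≤ x<d

    x<child : ∀ c → length x < length (x ++ [ c ])
    x<child c = ≤-reflexive (sym (length-∷ʳ x c))

    x≢first : x ≢ first
    x≢first = <⇒≢ (x<child zero) ∘ cong length

    child-vertex : ∀ c → IsVertex d (x ++ [ c ])
    child-vertex c = subst (_≤ d) (sym (length-∷ʳ x c)) x<d

    children-vertices : ∀ a → a ∈ children x → IsVertex d a
    children-vertices a a∈ with ∈-children⁻ a∈
    ... | c , refl = child-vertex c

    children∈δS : ∀ a → a ∈ children x → inBoundary S a ≡ true
    children∈δS a a∈ with ∈-children⁻ a∈
    ... | c , refl = inBoundary⁺ S (childless c) (inj₁ (c , refl)) Sx

    child-leaves-boundary : (v : Path Q) (c : Fin Q) → (∀ c′ → S ((x ++ [ c ]) ++ [ c′ ]) ≡ false)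
      → inBoundary (swapSet S x v) (x ++ [ c ]) ≡ true → Adjacent (x ++ [ c ]) v
    child-leaves-boundary v c grandchildren∉S δ with inBoundary⁻ (swapSet S x v) (x ++ [ c ]) δ
    ... | _ , z , x·c~z , S′z with swapSet-≡true⁻ S x v z S′z | x·c~z
    ...   | inj₁ refl | _ = x·c~z
    ...   | inj₂ (z≢x , _) | inj₁ (c′ , e) = contradiction (sym (∷ʳ-injectiveˡ x z e)) z≢x
    ...   | inj₂ (_ , Sz) | inj₂ (c′ , refl) = contradiction Sz (≡false⇒≢true (grandchildren∉S c′))

    first-saturated : ChildrenIn d S first → ⊥
    first-saturated first-children∈S =
      deeper-swap-grows-boundary x≤d (child-vertex zero) Sx (childless zero) (x<child zero)
        (BoundaryExchange.boundarySize-≤ exchange)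
      where
      entered : ∀ y → IsVertex d y → inBoundary (swapSet S x first) y ≡ true → inBoundary S y ≡ true ⊎ y ∈ [ x ]
      entered y y≤d δ with inBoundary-swapSet S x first y δ
      ... | inj₁ refl = inj₂ (here refl)
      ... | inj₂ (inj₁ δS) = inj₁ δS
      ... | inj₂ (inj₂ (Sy , _ , inj₁ (c , refl))) =
            contradiction (first-children∈S (subst (_≤ d) (length-∷ʳ first c) y≤d) c) (≡false⇒≢true Sy)
      ... | inj₂ (inj₂ (_ , y≢x , inj₂ (c , e))) = contradiction (sym (∷ʳ-injectiveˡ x y e)) y≢x

      exchange : BoundaryExchange d S (swapSet S x first)
      exchange = record
        { leaving = [ first ]
        ; entering = [ x ]
        ; leaving-vertices = λ { _ (here refl) → child-vertex zero }
        ; entering-vertices = λ { _ (here refl) → x≤d }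
        ; leaving-distinct = mult-[ first ]
        ; entering≤leaving = ≤-refl
        ; leaving⊆δS = λ { _ (here refl) → children∈δS first (∈-map⁺ _ (∈-allFin zero)) }
        ; δS′⊆δS∪entering = entered
        ; leaving∩δS′⊆entering = λ { _ (here refl) δ →
            contradiction (swapSet-target S x≢first) (inBoundary⇒∉ (swapSet S x first) {first} δ) }
        }

    module _ (grandchildren<d : suc (length x) < d) where
      grandchild-vertex : ∀ a b → IsVertex d ((x ++ [ a ]) ++ [ b ])
      grandchild-vertex a b = subst (_≤ d) (sym (length-grandchild x a b)) grandchildren<d

      ∉-right-of-grandchild : ∀ {a b} c c′ → a F.< b → S ((x ++ [ a ]) ++ [ c ]) ≡ false → S ((x ++ [ b ]) ++ [ c′ ]) ≡ false
      ∉-right-of-grandchild {a} {b} c c′ a<b =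
        ∉-rightward (grandchild-vertex b c′) (trans (length-grandchild x a c) (sym (length-grandchild x b c′)))
          (Lex-<-grandchild x c c′ a<b)

      first-mixed : ∀ c₀ → S (first ++ [ c₀ ]) ≡ false → ∀ t → S (first ++ [ t ]) ≡ true → ⊥
      first-mixed c₀ Sc₀ t St =
        deeper-swap-grows-boundary x≤d (child-vertex zero) Sx (childless zero) (x<child zero)
          (BoundaryExchange.boundarySize-≤ exchange)
        where
        first-first∈S : ∀ t → S (first ++ [ t ]) ≡ true → S (first ++ [ zero ]) ≡ true
        first-first∈S zero St = St
        first-first∈S (suc t) St = ¬-not λ S00 → contradiction St (≡false⇒≢true
          (∉-rightward (grandchild-vertex zero (suc t)) (length-sibling first zero (suc t))
            (Lex-<-after-prefix first [] [] (s≤s z≤n)) S00))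

        later-grandchildren∉S : ∀ i c → S ((x ++ [ suc i ]) ++ [ c ]) ≡ false
        later-grandchildren∉S i c = ∉-right-of-grandchild c₀ c (s≤s z≤n) Sc₀

        later-first-children : List (Path Q)
        later-first-children = map (λ i → first ++ [ suc i ]) (allFin (suc r))

        entered : ∀ y → IsVertex d y → inBoundary (swapSet S x first) y ≡ true
          → inBoundary S y ≡ true ⊎ y ∈ x ∷ later-first-children
        entered y y≤d δ with inBoundary-swapSet S x first y δ
        ... | inj₁ refl = inj₂ (here refl)
        ... | inj₂ (inj₁ δS) = inj₁ δS
        ... | inj₂ (inj₂ (Sy , _ , inj₁ (zero , refl))) = contradiction (first-first∈S t St) (≡false⇒≢true Sy)
        ... | inj₂ (inj₂ (Sy , _ , inj₁ (suc i , refl))) = inj₂ (there (∈-map⁺ _ (∈-allFin i)))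
        ... | inj₂ (inj₂ (_ , y≢x , inj₂ (c , e))) = contradiction (sym (∷ʳ-injectiveˡ x y e)) y≢x

        stays-out : ∀ y → y ∈ children x → inBoundary (swapSet S x first) y ≡ true → y ∈ x ∷ later-first-children
        stays-out y y∈ δ with ∈-children⁻ y∈
        ... | zero , refl = contradiction (swapSet-target S x≢first) (inBoundary⇒∉ (swapSet S x first) {first} δ)
        ... | suc i , refl = contradiction (length-sibling x (suc i) zero)
              (adjacent⇒length≢ (child-leaves-boundary first (suc i) (later-grandchildren∉S i) δ))

        exchange : BoundaryExchange d S (swapSet S x first)
        exchange = record
          { leaving = children x
          ; entering = x ∷ later-first-children
          ; leaving-vertices = children-vertices
          ; entering-vertices = λ where
              _ (here refl) → x≤d
              _ (there a∈) → case-later a∈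
          ; leaving-distinct = mult-children-≤1 x
          ; entering≤leaving = ≤-reflexive (trans (cong suc (trans (length-map _ (allFin (suc r))) (length-tabulate id)))
                                                  (sym (length-children x)))
          ; leaving⊆δS = children∈δS
          ; δS′⊆δS∪entering = entered
          ; leaving∩δS′⊆entering = stays-out
          }
          where
          case-later : ∀ {a} → a ∈ later-first-children → IsVertex d a
          case-later a∈ with ∈-map⁻ _ a∈
          ... | i , _ , refl = grandchild-vertex zero (suc i)

      first-childless : (∀ t → S (first ++ [ t ]) ≡ false) → ⊥
      first-childless first-children∉S
        with ∉-descendant-with-children-in d S (grandchild-vertex zero zero) (first-children∉S zero)
      ... | v , (t , refl) , v≤d , Sv , v-children∈S =
        deeper-swap-grows-boundary x≤d v≤d Sx Sv (≤-trans (n≤1+n _) x+2≤|v|)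
          (BoundaryExchange.boundarySize-≤ exchange)
        where
        x+2≤|v| : suc (suc (length x)) ≤ length v
        x+2≤|v| = ≤-trans (≤-reflexive (sym (length-grandchild x zero zero)))
                    (subst (_ ≤_) (sym (length-++ ((x ++ [ zero ]) ++ [ zero ]))) (m≤m+n _ (length t)))

        grandchildren∉S : ∀ i c → S ((x ++ [ i ]) ++ [ c ]) ≡ false
        grandchildren∉S zero c = first-children∉S c
        grandchildren∉S (suc i) c = ∉-right-of-grandchild zero c (s≤s z≤n) (first-children∉S zero)

        newcomers : List (Path Q)
        newcomers = x ∷ dropLast v ∷ []

        entered : ∀ y → IsVertex d y → inBoundary (swapSet S x v) y ≡ true → inBoundary S y ≡ true ⊎ y ∈ newcomers
        entered y y≤d δ with inBoundary-swapSet S x v y δ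
        ... | inj₁ refl = inj₂ (here refl)
        ... | inj₂ (inj₁ δS) = inj₁ δS
        ... | inj₂ (inj₂ (Sy , _ , inj₁ (c , refl))) =
              contradiction (v-children∈S (subst (_≤ d) (length-∷ʳ v c) y≤d) c) (≡false⇒≢true Sy)
        ... | inj₂ (inj₂ (_ , _ , inj₂ (c , v≡y·c))) = inj₂ (there (here (sym (trans (cong dropLast v≡y·c) (dropLast-∷ʳ y c)))))

        stays-out : ∀ y → y ∈ children x → inBoundary (swapSet S x v) y ≡ true → y ∈ newcomers
        stays-out y y∈ δ with ∈-children⁻ y∈
        ... | c , refl with child-leaves-boundary v c (grandchildren∉S c) δ
        ...   | inj₁ (c′ , x·c≡v·c′) = contradiction (subst (_≤ length v) (sym (length-∷ʳ x c)) (≤-trans (n≤1+n _) x+2≤|v|))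
                                          (<⇒≱ (≤-reflexive (trans (sym (length-∷ʳ v c′)) (cong length (sym x·c≡v·c′)))))
        ...   | inj₂ (c′ , v≡x·c·c′) = there (here (sym (trans (cong dropLast v≡x·c·c′) (dropLast-∷ʳ (x ++ [ c ]) c′))))

        exchange : BoundaryExchange d S (swapSet S x v)
        exchange = record
          { leaving = children x
          ; entering = newcomers
          ; leaving-vertices = children-vertices
          ; entering-vertices = λ where
              _ (here refl) → x≤d
              _ (there (here refl)) → ≤-trans (length-dropLast v) v≤d
          ; leaving-distinct = mult-children-≤1 x
          ; entering≤leaving = subst (2 ≤_) (sym (length-children x)) (s≤s (s≤s z≤n))
          ; leaving⊆δS = children∈δS
          ; δS′⊆δS∪entering = entered
          ; leaving∩δS′⊆entering = stays-out
          }

    impossible : ⊥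
    impossible with suc (length x) <? d
    ... | no ¬grandchildren<d = first-saturated λ first<d →
          contradiction (subst (_< d) (length-∷ʳ x zero) first<d) ¬grandchildren<d
    ... | yes grandchildren<d
        with FP.any? (λ c → S (first ++ [ c ]) BP.≟ false) | FP.any? (λ t → S (first ++ [ t ]) BP.≟ true)
    ...   | no none∉S | _ = first-saturated λ _ c → ¬-not (none∉S ∘ (c ,_))
    ...   | yes (c₀ , Sc₀) | yes (t , St) = first-mixed grandchildren<d c₀ Sc₀ t St
    ...   | yes _ | no none∈S = first-childless grandchildren<d λ t → ¬-not (none∈S ∘ (t ,_))

  member-has-child-in-S : {x : Path Q} → length x < d → S x ≡ true → ∃ λ c → S (x ++ [ c ]) ≡ true
  member-has-child-in-S {x} x<d Sx with FP.any? (λ c → S (x ++ [ c ]) BP.≟ true)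
  ... | yes found = found
  ... | no none = ⊥-elim (Childless.impossible x<d Sx λ c → ¬-not (none ∘ (c ,_)))

  descendant-in-S-below : ∀ k {u x : Path Q} → InDesc u x → S x ≡ true → k + length x ≤ d
    → ∃ λ y → InDesc u y × S y ≡ true × length y ≡ k + length x
  descendant-in-S-below zero {x = x} x∈Desc-u Sx _ = x , x∈Desc-u , Sx , refl
  descendant-in-S-below (suc k) {u} {x} (w , refl) Sx bound
    with member-has-child-in-S (≤-trans (s≤s (m≤n+m (length x) k)) bound) Sx
  ... | c , Sxc with descendant-in-S-below k (w ++ [ c ] , ++-assoc u w [ c ]) Sxc (subst (_≤ d) (sym (+-length-∷ʳ k x c)) bound)
  ...   | y , y∈Desc-u , Sy , |y|≡ = y , y∈Desc-u , Sy , trans |y|≡ (+-length-∷ʳ k x c)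

lemma2p5 : (q d : ℕ) → 2 ≤ q → (S : VSubset q) → ValidSubset d S
    → LeftCompressed d S → DownCompressed d S
    → (u : Path q) → IsVertex d u → (i : ℕ)
    → (∃ λ x → InDesc u x × x ∈S S × length x ≡ i)
    → (i′ : ℕ) → i ≤ i′ → i′ ≤ d
    → ∃ λ x → InDesc u x × x ∈S S × length x ≡ i′
lemma2p5 (suc (suc r)) d (s≤s (s≤s z≤n)) S _ left-compressed down-compressed u _ _ (x , x∈Desc-u , Sx , refl) i′ i≤i′ i′≤d
  with Compressed.descendant-in-S-below r d S left-compressed down-compressed (i′ ∸ length x) x∈Desc-u Sx
         (≤-trans (≤-reflexive (m∸n+n≡m i≤i′)) i′≤d)
... | y , y∈Desc-u , Sy , |y|≡ = y , y∈Desc-u , Sy , trans |y|≡ (m∸n+n≡m i≤i′)
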